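{- Let $n\geq4$ and let $j_0\in\{3,\ldots,n-1\}$. If $M=(a_{i,j})$ and $M'=(a'_{i,j})$ are Steinhaus matrices of size $n$ with $T(M)=T(M')$, $a_{1,2}=a'_{1,2}$, $a_{1,j_0}=a'_{1,j_0}$ and $a_{1,n}=a'_{1,n}$, then $M=M'$. That is, the extension $M$ of $T(M)$ only depends on the parameters $a_{1,2}$, $a_{1,j_0}$ and $a_{1,n}$.
   Context: A Steinhaus matrix of size $n\geq1$ is a matrix $M=(a_{i,j})_{1\leq i,j\leq n}$ with entries in $\mathbb{F}_2=\{0,1\}$ such that $a_{i,i}=0$ for all $i$, $a_{i,j}=a_{i-1,j-1}+a_{i-1,j}$ (addition in $\mathbb{F}_2$) for all $2\leq i<j\leq n$, and $a_{i,j}=a_{j,i}$ for all $i,j$. For a Steinhaus matrix $M=(a_{i,j})$ of size $n\geq 4$, $T(M)=(b_{i,j})$ is the Steinhaus matrix of size $n-3$ defined by $b_{i,j}=a_{i+1,j+2}$ for all $1\leq i<j\leq n-3$ (with zero diagonal and symmetric); it is indeed a Steinhaus matrix. -}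

module Defs where

open import Data.Nat using (ℕ; zero; suc; _<_; _≤_; _+_)
open import Data.Nat.Properties using (<-cmp)
open import Data.Bool using (Bool; false; true; _xor_)
open import Data.Fin using (Fin; toℕ; inject₁) renaming (zero to fzero; suc to fsuc)
open import Relation.Binary.Definitions using (tri<; tri≈; tri>)
open import Relation.Binary.PropositionalEquality using (_≡_)

-- A square matrix of size n over F₂ = Bool (xor is addition in F₂),
-- indexed 0-based: entry a_{i+1,j+1} of the paper is M i j.
Matrix : ℕ → Set
Matrix n = Fin n → Fin n → Bool

-- Steinhaus matrix (paper's definition, shifted to 0-based indices):
--  * a_{i,i} = 0
--  * a_{i,j} = a_{i-1,j-1} + a_{i-1,j} for 2 ≤ i < j ≤ n
--    (0-based: for row index i+1 and column index j+1 with i+1 < j+1,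
--     in a matrix of size suc n, rows/columns i, j : Fin n)
--  * a_{i,j} = a_{j,i}
record IsSteinhaus {n : ℕ} (M : Matrix (suc n)) : Set where
  field
    diag : ∀ (i : Fin (suc n)) → M i i ≡ false
    rule : ∀ (i j : Fin n) → toℕ i < toℕ j →
             M (fsuc i) (fsuc j) ≡ M (inject₁ i) (inject₁ j) xor M (inject₁ i) (fsuc j)
    symm : ∀ (i j : Fin (suc n)) → M i j ≡ M j i

-- The operator T: for M of size m+3, T(M) has size m with
-- b_{i,j} = a_{i+1,j+2} for i < j (1-based; the same shift in 0-based),
-- zero diagonal, and symmetric.
T : ∀ {m : ℕ} → Matrix (suc (suc (suc m))) → Matrix m
T M i j with <-cmp (toℕ i) (toℕ j)
... | tri< _ _ _ = M (inject₁ (inject₁ (fsuc i))) (fsuc (fsuc (inject₁ j)))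
... | tri≈ _ _ _ = false
... | tri> _ _ _ = M (inject₁ (inject₁ (fsuc j))) (fsuc (fsuc (inject₁ i)))

-- Row 2 of a Steinhaus matrix is the sequence of sums a₁ⱼ + a₁,ⱼ₊₁ of consecutive
-- entries of row 1, and T(M) contains a₂ⱼ for 4 ≤ j ≤ n − 1. Hence T(M) = T(M')
-- makes the difference of the first rows of M and M' constant on the indices
-- 3, …, n − 1; it vanishes at j₀, so the first rows agree there, and they agree
-- at 1, 2 and n by hypothesis. The Steinhaus rule then propagates the first row
-- down the upper triangle, and symmetry gives the rest.
module Submission where

open import Defs
open import Data.Nat using (ℕ; suc; _≤_; _<_; z≤n; s≤s)
open import Data.Nat.Properties using (m≤n⇒m<n∨m≡n; m≤n⇒m≤1+n; ≤-total; <-irrefl)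
open import Data.Fin using (Fin; toℕ; fromℕ; inject₁) renaming (zero to fzero; suc to fsuc)
open import Data.Fin.Properties using (toℕ-inject₁; toℕ-injective; toℕ-fromℕ)
open import Data.Fin.Induction using (<-weakInduction)
open import Data.Fin.Relation.Unary.Top using (view; ‵fromℕ; ‵inject₁)
open import Data.Bool using (Bool; true; false; _xor_)
open import Data.Bool.Properties using (xor-same; xor-∧-commutativeRing)
open import Algebra.Bundles using (CommutativeRing)
open import Algebra.Properties.CommutativeSemigroup
  (CommutativeRing.+-commutativeSemigroup xor-∧-commutativeRing) using (interchange)
open import Data.Sum using (inj₁; inj₂)
open import Data.Empty using (⊥-elim)
open import Relation.Binary.PropositionalEquality

open IsSteinhaus

xor≡false⇒≡ : ∀ x y → x xor y ≡ false → x ≡ y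
xor≡false⇒≡ false y eq = sym eq
xor≡false⇒≡ true true eq = refl

inject₁≡suc⇒constant : ∀ {a} {A : Set a} {p} (h : Fin (suc p) → A) →
                       (∀ i → h (inject₁ i) ≡ h (fsuc i)) → ∀ i j → h i ≡ h j
inject₁≡suc⇒constant h step i j = trans (≡h₀ i) (sym (≡h₀ j))
  where
  ≡h₀ : ∀ i → h i ≡ h fzero
  ≡h₀ = <-weakInduction (λ i → h i ≡ h fzero) refl
          (λ i hi≡h₀ → trans (sym (step i)) hi≡h₀)

consecutive-xor-determines : ∀ {p} (f g : Fin (suc p) → Bool) →
  (∀ i → f (inject₁ i) xor f (fsuc i) ≡ g (inject₁ i) xor g (fsuc i)) →
  ∀ k → f k ≡ g k → ∀ i → f i ≡ g i
consecutive-xor-determines f g sums≡ k fk≡gk i =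
  xor≡false⇒≡ (f i) (g i) (begin
    δ i ≡⟨ inject₁≡suc⇒constant δ δ-step i k ⟩
    δ k ≡⟨ cong (_xor g k) fk≡gk ⟩
    g k xor g k ≡⟨ xor-same (g k) ⟩
    false ∎)
  where
  open ≡-Reasoning
  δ : Fin _ → Bool
  δ i = f i xor g i
  δ-step : ∀ i → δ (inject₁ i) ≡ δ (fsuc i)
  δ-step i = xor≡false⇒≡ _ _ (begin
    δ (inject₁ i) xor δ (fsuc i)
      ≡⟨ interchange (f (inject₁ i)) (g (inject₁ i)) (f (fsuc i)) (g (fsuc i)) ⟩
    (f (inject₁ i) xor f (fsuc i)) xor (g (inject₁ i) xor g (fsuc i))
      ≡⟨ cong (_xor (g (inject₁ i) xor g (fsuc i))) (sums≡ i) ⟩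
    (g (inject₁ i) xor g (fsuc i)) xor (g (inject₁ i) xor g (fsuc i))
      ≡⟨ xor-same (g (inject₁ i) xor g (fsuc i)) ⟩
    false ∎)

module _ {n} {M M' : Matrix (suc n)} (S : IsSteinhaus M) (S' : IsSteinhaus M')
         (row₀≡ : ∀ j → M fzero j ≡ M' fzero j) where

  row₀≡⇒upper≡ : ∀ i j → toℕ i ≤ toℕ j → M i j ≡ M' i j
  row₀≡⇒upper≡ = <-weakInduction Agrees row₀≡′ next
    where
    Agrees : Fin (suc n) → Set
    Agrees i = ∀ j → toℕ i ≤ toℕ j → M i j ≡ M' i j

    row₀≡′ : Agrees fzero
    row₀≡′ j _ = row₀≡ j

    next : ∀ i → Agrees (inject₁ i) → Agrees (fsuc i)
    next i ih (fsuc j) (s≤s i≤j) with m≤n⇒m<n∨m≡n i≤j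
    ... | inj₂ i≡j rewrite toℕ-injective i≡j = trans (diag S (fsuc j)) (sym (diag S' (fsuc j)))
    ... | inj₁ i<j = begin
      M (fsuc i) (fsuc j)                                   ≡⟨ rule S i j i<j ⟩
      M (inject₁ i) (inject₁ j) xor M (inject₁ i) (fsuc j)  ≡⟨ cong₂ _xor_ left right ⟩
      M' (inject₁ i) (inject₁ j) xor M' (inject₁ i) (fsuc j) ≡⟨ sym (rule S' i j i<j) ⟩
      M' (fsuc i) (fsuc j)                                  ∎
      where
      open ≡-Reasoning
      left = ih (inject₁ j) (subst₂ _≤_ (sym (toℕ-inject₁ i)) (sym (toℕ-inject₁ j)) i≤j)
      right = ih (fsuc j) (subst (_≤ suc (toℕ j)) (sym (toℕ-inject₁ i)) (m≤n⇒m≤1+n i≤j))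

  row₀≡⇒≡ : ∀ i j → M i j ≡ M' i j
  row₀≡⇒≡ i j with ≤-total (toℕ i) (toℕ j)
  ... | inj₁ i≤j = row₀≡⇒upper≡ i j i≤j
  ... | inj₂ j≤i = trans (symm S i j) (trans (row₀≡⇒upper≡ j i j≤i) (symm S' j i))

proposition4 : (m : ℕ) → 1 ≤ m →
    (M M' : Matrix (suc (suc (suc m)))) → IsSteinhaus M → IsSteinhaus M' →
    (k : Fin (suc (suc (suc m)))) → 2 ≤ toℕ k → toℕ k < suc (suc m) →
    (∀ i j → T M i j ≡ T M' i j) →
    M fzero (fsuc fzero) ≡ M' fzero (fsuc fzero) →
    M fzero k ≡ M' fzero k →
    M fzero (fromℕ (suc (suc m))) ≡ M' fzero (fromℕ (suc (suc m))) →
    ∀ i j → M i j ≡ M' i j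
proposition4 (suc m) _ M M' S S' (fsuc (fsuc x)) (s≤s (s≤s _)) (s≤s (s≤s x<)) T≡ a₁₂≡ a₁ⱼ₀≡ a₁ₙ≡ =
  row₀≡⇒≡ S S' row₀≡
  where
  middle middle' : Fin (suc m) → Bool
  middle i = M fzero (fsuc (fsuc (inject₁ i)))
  middle' i = M' fzero (fsuc (fsuc (inject₁ i)))

  -- T M 0 (i+1) is M 1 (i+3), which the Steinhaus rule writes as such a sum.
  sums≡ : ∀ i → middle (inject₁ i) xor middle (fsuc i) ≡ middle' (inject₁ i) xor middle' (fsuc i)
  sums≡ i = trans (sym (rule S fzero (fsuc (fsuc (inject₁ i))) (s≤s z≤n)))
              (trans (T≡ fzero (fsuc i)) (rule S' fzero (fsuc (fsuc (inject₁ i))) (s≤s z≤n)))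

  middle≡ : ∀ i → middle i ≡ middle' i
  middle≡ with view x
  ... | ‵fromℕ = ⊥-elim (<-irrefl (toℕ-fromℕ (suc m)) x<)
  ... | ‵inject₁ j₀ = consecutive-xor-determines middle middle' sums≡ j₀ a₁ⱼ₀≡

  row₀≡ : ∀ j → M fzero j ≡ M' fzero j
  row₀≡ fzero = trans (diag S fzero) (sym (diag S' fzero))
  row₀≡ (fsuc fzero) = a₁₂≡
  row₀≡ (fsuc (fsuc j)) with view j
  ... | ‵fromℕ = a₁ₙ≡
  ... | ‵inject₁ i = middle≡ i
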